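{- Let $D$ be a directed convex polyomino with root cell $S$, and let $k\ge 1$. Then $D$ is $k$-convex if and only if for every cell $c$ of $D$ there is a path connecting $S$ to $c$ with at most $k$ changes of direction.
   Context: A cell is a unit square of $\mathbb{Z}\times\mathbb{Z}$; a polyomino is a finite connected union of cells. Convex: intersection with every horizontal and vertical line connected. Directed: every cell reachable from a distinguished cell $S$ (the root) by a path of north and east unit steps inside the polyomino. A path connecting two cells $b,c$ of $P$ is a self-avoiding sequence of unit steps north, south, east, west, entirely contained in $P$, from the center of $b$ to the center of $c$; it is monotone if it uses only two step types; a change of direction is a pair of consecutive steps that differ. A convex polyomino is $k$-convex if every pair of its cells can be connected by a monotone path with at most $k$ changes of direction. -}

module Defs where

open import Data.Nat using (ℕ; zero; suc; _+_)
import Data.Nat as ℕ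
open import Data.Integer using (ℤ; _≤_) renaming (_+_ to _+ℤ_; _-_ to _-ℤ_)
open import Data.Integer.Properties using () renaming (_≟_ to _≟ℤ_)
open import Data.Product using (_×_; _,_; ∃; ∃-syntax)
open import Data.Product.Properties using (≡-dec)
open import Data.Sum using (_⊎_)
open import Data.List using (List; []; _∷_)
open import Data.List.Relation.Unary.All using (All)
open import Data.List.Relation.Unary.Unique.Propositional using (Unique)
open import Data.List.Membership.Propositional using (_∈_)
open import Relation.Binary.PropositionalEquality using (_≡_)
open import Relation.Nullary using (does)
open import Data.Bool using (if_then_else_)

-- A cell is identified with its lower-left corner (equivalently its center) in ℤ × ℤ.
Cell : Set
Cell = ℤ × ℤ

-- A finite set of cells, given as a list (duplicates are harmless).
CellSet : Set
CellSet = List Cell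

data Step : Set where
  N S E W : Step

move : Step → Cell → Cell
move N (x , y) = (x , y +ℤ Data.Integer.+ 1)
move S (x , y) = (x , y -ℤ Data.Integer.+ 1)
move E (x , y) = (x +ℤ Data.Integer.+ 1 , y)
move W (x , y) = (x -ℤ Data.Integer.+ 1 , y)

visits : Cell → List Step → List Cell
visits b []       = b ∷ []
visits b (s ∷ ss) = b ∷ visits (move s b) ss

endCell : Cell → List Step → Cell
endCell b []       = b
endCell b (s ∷ ss) = endCell (move s b) ss

IsPath : CellSet → Cell → Cell → List Step → Set
IsPath P b c ss = Unique (visits b ss) × All (_∈ P) (visits b ss) × endCell b ss ≡ c

stepCode : Step → ℕ
stepCode N = 0
stepCode S = 1
stepCode E = 2
stepCode W = 3

differ : Step → Step → ℕ
differ s t = if does (stepCode s ℕ.≟ stepCode t) then 0 else 1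

changes : List Step → ℕ
changes (s ∷ t ∷ ss) = differ s t + changes (t ∷ ss)
changes _            = 0

Monotone : List Step → Set
Monotone ss = ∃[ s ] ∃[ t ] All (λ u → u ≡ s ⊎ u ≡ t) ss

Polyomino : CellSet → Set
Polyomino P = ∀ b c → b ∈ P → c ∈ P → ∃[ ss ] IsPath P b c ss

Convex : CellSet → Set
Convex P =
  (∀ x y₁ y₂ y → (x , y₁) ∈ P → (x , y₂) ∈ P → y₁ ≤ y → y ≤ y₂ → (x , y) ∈ P) ×
  (∀ y x₁ x₂ x → (x₁ , y) ∈ P → (x₂ , y) ∈ P → x₁ ≤ x → x ≤ x₂ → (x , y) ∈ P)

Directed : CellSet → Cell → Set
Directed P R =
  R ∈ P × (∀ c → c ∈ P → ∃[ ss ] All (λ u → u ≡ N ⊎ u ≡ E) ss × IsPath P R c ss)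

KConvex : ℕ → CellSet → Set
KConvex k P = Convex P ×
  (∀ b c → b ∈ P → c ∈ P → ∃[ ss ] Monotone ss × IsPath P b c ss × changes ss ℕ.≤ k)

-- Collapsing each straight run of a path from the root S to c with at most k turns
-- leaves a chain of at most k + 1 links between cells of D from S to c, consecutive
-- cells sharing a row or column. A directed convex polyomino is closed under componentwise meets, and
-- under joins of cells with a common upper bound in it: the north-east path from S to
-- the relevant cell must cross the row or the column through the meet (join), and
-- convexity fills in the rest. For b below and to the left of c, the meets of the
-- suffixes of the chain, joined with b, form a monotone chain from b to c with at most
-- k + 1 links, and convexity fills each of its straight runs. Two cells that are not
-- so ordered are joined through one corner, which is where k ≥ 1 is used.

module Submission where

open import Defs
open import Data.Nat using (ℕ; _≤_)
open import Data.Product using (_×_; ∃-syntax)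
open import Data.List.Membership.Propositional using (_∈_)
open import Function.Bundles using (_⇔_)

open import Data.Nat as ℕ using (zero; suc; _∸_; z≤n; s≤s)
import Data.Nat.Properties as ℕₚ
open import Data.Integer as ℤ using (ℤ; +_; _⊓_; _⊔_)
import Data.Integer.Properties as ℤₚ
open import Data.Integer.Tactic.RingSolver using (solve-∀)
open import Data.Product using (_,_; proj₁; proj₂)
open import Data.Sum using (_⊎_; inj₁; inj₂)
open import Data.List using ([]; _∷_; _++_; replicate)
open import Data.List.Relation.Unary.All as All using (All; []; _∷_)
open import Data.List.Relation.Unary.All.Properties using (++⁺; replicate⁺)
open import Data.List.Relation.Unary.Any using (Any; here; there)
open import Data.List.Relation.Unary.AllPairs using ([]; _∷_)
open import Data.List.Relation.Unary.Unique.Propositional using (Unique)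
open import Relation.Binary.PropositionalEquality
  using (_≡_; refl; sym; trans; cong; cong₂; subst; subst₂; module ≡-Reasoning)
open import Relation.Nullary using (¬_; Dec; yes; no)
open import Relation.Nullary.Decidable using (_×-dec_; _⊎-dec_)
open import Function.Bundles using (mk⇔)

open ≡-Reasoning

visits-++ : ∀ {P : Cell → Set} p xs ys → All P (visits p xs) →
  All P (visits (endCell p xs) ys) → All P (visits p (xs ++ ys))
visits-++ p []       ys _        qs = qs
visits-++ p (x ∷ xs) ys (q ∷ ps) qs = q ∷ visits-++ (move x p) xs ys ps qs

endCell-++ : ∀ p xs ys → endCell p (xs ++ ys) ≡ endCell (endCell p xs) ys
endCell-++ p []       ys = refl
endCell-++ p (x ∷ xs) ys = endCell-++ (move x p) xs ys

All-endCell : ∀ {P : Cell → Set} p ss → All P (visits p ss) → P (endCell p ss)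
All-endCell p []       (q ∷ []) = q
All-endCell p (s ∷ ss) (_ ∷ qs) = All-endCell (move s p) ss qs

differ-self : ∀ s → differ s s ≡ 0
differ-self N = refl
differ-self S = refl
differ-self E = refl
differ-self W = refl

≡⊎differ≡1 : ∀ s t → s ≡ t ⊎ differ s t ≡ 1
≡⊎differ≡1 N N = inj₁ refl
≡⊎differ≡1 N S = inj₂ refl
≡⊎differ≡1 N E = inj₂ refl
≡⊎differ≡1 N W = inj₂ refl
≡⊎differ≡1 S N = inj₂ refl
≡⊎differ≡1 S S = inj₁ refl
≡⊎differ≡1 S E = inj₂ refl
≡⊎differ≡1 S W = inj₂ refl
≡⊎differ≡1 E N = inj₂ refl
≡⊎differ≡1 E S = inj₂ refl
≡⊎differ≡1 E E = inj₁ refl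
≡⊎differ≡1 E W = inj₂ refl
≡⊎differ≡1 W N = inj₂ refl
≡⊎differ≡1 W S = inj₂ refl
≡⊎differ≡1 W E = inj₂ refl
≡⊎differ≡1 W W = inj₁ refl

differ≤1 : ∀ s t → differ s t ≤ 1
differ≤1 s t with ≡⊎differ≡1 s t
... | inj₁ refl = ℕₚ.≤-trans (ℕₚ.≤-reflexive (differ-self s)) z≤n
... | inj₂ d≡1  = ℕₚ.≤-reflexive d≡1

changes-repeat : ∀ s ss → changes (s ∷ s ∷ ss) ≡ changes (s ∷ ss)
changes-repeat s ss = cong (ℕ._+ changes (s ∷ ss)) (differ-self s)

changes-replicate : ∀ n d → changes (replicate n d) ≡ 0
changes-replicate zero          d = refl
changes-replicate (suc zero)    d = refl
changes-replicate (suc (suc n)) d =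
  trans (changes-repeat d (replicate n d)) (changes-replicate (suc n) d)

changes-replicate-++ : ∀ n d ys → changes (replicate n d ++ ys) ≤ suc (changes ys)
changes-replicate-++ zero          d ys       = ℕₚ.n≤1+n _
changes-replicate-++ (suc zero)    d []       = z≤n
changes-replicate-++ (suc zero)    d (y ∷ ys) = ℕₚ.+-monoˡ-≤ (changes (y ∷ ys)) (differ≤1 d y)
changes-replicate-++ (suc (suc n)) d ys =
  subst (_≤ suc (changes ys)) (sym (changes-repeat d (replicate n d ++ ys)))
        (changes-replicate-++ (suc n) d ys)

-- Self-avoidance

module _ (φ : Cell → ℤ) where

  Increases : Step → Set
  Increases d = ∀ q → φ q ℤ.< φ (move d q)

  visits-≥ : ∀ p ss → All Increases ss → All (λ q → φ p ℤ.≤ φ q) (visits p ss)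
  visits-≥ p []       []           = ℤₚ.≤-refl ∷ []
  visits-≥ p (d ∷ ss) (inc ∷ incs) =
    ℤₚ.≤-refl ∷ All.map (ℤₚ.≤-trans (ℤₚ.<⇒≤ (inc p))) (visits-≥ (move d p) ss incs)

  visits-unique : ∀ p ss → All Increases ss → Unique (visits p ss)
  visits-unique p []       []           = [] ∷ []
  visits-unique p (d ∷ ss) (inc ∷ incs) =
    All.map (λ φp′≤φq p≡q → ℤₚ.<-irrefl (cong φ p≡q) (ℤₚ.<-≤-trans (inc p) φp′≤φq))
            (visits-≥ (move d p) ss incs)
    ∷ visits-unique (move d p) ss incs

data Vertical : Step → Set where
  north : Vertical N
  south : Vertical S

data Horizontal : Step → Set where
  east : Horizontal E
  west : Horizontal W

i<i+1 : ∀ i → i ℤ.< i ℤ.+ + 1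
i<i+1 i = ℤₚ.suc[i]≤j⇒i<j (ℤₚ.≤-reflexive (ℤₚ.+-comm (+ 1) i))

i-1<i : ∀ i → i ℤ.- + 1 ℤ.< i
i-1<i i = ℤₚ.i≤pred[j]⇒i<j (ℤₚ.≤-reflexive (ℤₚ.+-comm i (ℤ.- + 1)))

orient : Step → ℤ → ℤ
orient N t = t
orient E t = t
orient S t = ℤ.- t
orient W t = ℤ.- t

potential : Step → Step → Cell → ℤ
potential h v (x , y) = orient v x ℤ.+ orient h y

potential-vertical : ∀ {h} → Vertical h → ∀ v → Increases (potential h v) h
potential-vertical north v (x , y) = ℤₚ.+-monoʳ-< (orient v x) (i<i+1 y)
potential-vertical south v (x , y) = ℤₚ.+-monoʳ-< (orient v x) (ℤₚ.neg-mono-< (i-1<i y))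

potential-horizontal : ∀ {v} → Horizontal v → ∀ h → Increases (potential h v) v
potential-horizontal east h (x , y) = ℤₚ.+-monoˡ-< (orient h y) (i<i+1 x)
potential-horizontal west h (x , y) = ℤₚ.+-monoˡ-< (orient h y) (ℤₚ.neg-mono-< (i-1<i x))

-- Straight runs in a convex set

ConvexAlong : CellSet → (ℤ → Cell) → Set
ConvexAlong D f = ∀ {t₁ t₂ t} → f t₁ ∈ D → f t₂ ∈ D → t₁ ℤ.≤ t → t ℤ.≤ t₂ → f t ∈ D

Run : CellSet → Step → Cell → Cell → Set
Run D d a b = ∃[ n ] All (_∈ D) (visits a (replicate n d)) × endCell a (replicate n d) ≡ b

module _ {D : CellSet} (f : ℤ → Cell) {d : Step}
         (shift : ∀ t → move d (f t) ≡ f (t ℤ.+ + 1)) (convex : ConvexAlong D f) where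

  private
    +-cancel : ∀ t t′ → t ℤ.+ (t′ ℤ.- t) ≡ t′
    +-cancel = solve-∀

    +-suc : ∀ t n → (t ℤ.+ + 1) ℤ.+ + n ≡ t ℤ.+ + suc n
    +-suc t n = trans (ℤₚ.+-assoc t (+ 1) (+ n)) (cong (ℤ._+_ t) (sym (ℤₚ.pos-+ 1 n)))

    endCell-run : ∀ n t → endCell (f t) (replicate n d) ≡ f (t ℤ.+ + n)
    endCell-run zero    t = cong f (sym (ℤₚ.+-identityʳ t))
    endCell-run (suc n) t = begin
      endCell (move d (f t)) (replicate n d)  ≡⟨ cong (λ c → endCell c (replicate n d)) (shift t) ⟩
      endCell (f (t ℤ.+ + 1)) (replicate n d) ≡⟨ endCell-run n (t ℤ.+ + 1) ⟩
      f ((t ℤ.+ + 1) ℤ.+ + n)                 ≡⟨ cong f (+-suc t n) ⟩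
      f (t ℤ.+ + suc n)                       ∎

    run-⊆ : ∀ n {t₀} t → f t₀ ∈ D → t₀ ℤ.≤ t → f (t ℤ.+ + n) ∈ D →
      All (_∈ D) (visits (f t) (replicate n d))
    run-⊆ zero    t f₀∈D t₀≤t f₁∈D = convex f₀∈D f₁∈D t₀≤t (ℤₚ.i≤i+j t (+ 0)) ∷ []
    run-⊆ (suc n) t f₀∈D t₀≤t f₁∈D =
      convex f₀∈D f₁∈D t₀≤t (ℤₚ.i≤i+j t (+ suc n)) ∷
      subst (λ c → All (_∈ D) (visits c (replicate n d))) (sym (shift t))
        (run-⊆ n (t ℤ.+ + 1) f₀∈D (ℤₚ.≤-trans t₀≤t (ℤₚ.i≤i+j t (+ 1)))
          (subst (λ s → f s ∈ D) (sym (+-suc t n)) f₁∈D))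

  run-up : ∀ {t t′} → f t ∈ D → f t′ ∈ D → t ℤ.≤ t′ → Run D d (f t) (f t′)
  run-up {t} {t′} ft∈D ft′∈D t≤t′ =
    ℤ.∣ t′ ℤ.- t ∣ ,
    run-⊆ _ t ft∈D ℤₚ.≤-refl (subst (λ s → f s ∈ D) (sym reach) ft′∈D) ,
    trans (endCell-run _ t) (cong f reach)
    where
    reach : t ℤ.+ + ℤ.∣ t′ ℤ.- t ∣ ≡ t′
    reach = begin
      t ℤ.+ + ℤ.∣ t′ ℤ.- t ∣ ≡⟨ cong (ℤ._+_ t) (ℤₚ.0≤i⇒+∣i∣≡i (ℤₚ.i≤j⇒0≤j-i t≤t′)) ⟩
      t ℤ.+ (t′ ℤ.- t)       ≡⟨ +-cancel t t′ ⟩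
      t′                     ∎

run-down : ∀ {D} (f : ℤ → Cell) {d} → (∀ t → move d (f t) ≡ f (t ℤ.- + 1)) → ConvexAlong D f →
  ∀ {t t′} → f t ∈ D → f t′ ∈ D → t′ ℤ.≤ t → Run D d (f t) (f t′)
run-down {D} f {d} shift convex {t} {t′} ft∈D ft′∈D t′≤t =
  subst₂ (Run D d) (cong f (ℤₚ.neg-involutive t)) (cong f (ℤₚ.neg-involutive t′))
    (run-up f⁻ shift⁻ convex⁻ (at t ft∈D) (at t′ ft′∈D) (ℤₚ.neg-mono-≤ t′≤t))
  where
  f⁻ : ℤ → Cell
  f⁻ s = f (ℤ.- s)
  at : ∀ s → f s ∈ D → f⁻ (ℤ.- s) ∈ D
  at s = subst (_∈ D) (cong f (sym (ℤₚ.neg-involutive s)))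
  shift⁻ : ∀ s → move d (f⁻ s) ≡ f⁻ (s ℤ.+ + 1)
  shift⁻ s = trans (shift (ℤ.- s)) (cong f (sym (ℤₚ.neg-distrib-+ s (+ 1))))
  convex⁻ : ConvexAlong D f⁻
  convex⁻ f₁∈D f₂∈D t₁≤t t≤t₂ = convex f₂∈D f₁∈D (ℤₚ.neg-mono-≤ t≤t₂) (ℤₚ.neg-mono-≤ t₁≤t)

module _ {D : CellSet} (conv : Convex D) where

  column-convex : ∀ {p q r} → p ∈ D → q ∈ D → proj₁ p ≡ proj₁ r → proj₁ q ≡ proj₁ r →
    proj₂ p ℤ.≤ proj₂ r → proj₂ r ℤ.≤ proj₂ q → r ∈ D
  column-convex {_ , y₁} {_ , y₂} {x , y} p∈D q∈D refl refl = proj₁ conv x y₁ y₂ y p∈D q∈D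

  row-convex : ∀ {p q r} → p ∈ D → q ∈ D → proj₂ p ≡ proj₂ r → proj₂ q ≡ proj₂ r →
    proj₁ p ℤ.≤ proj₁ r → proj₁ r ℤ.≤ proj₁ q → r ∈ D
  row-convex {x₁ , _} {x₂ , _} {x , y} p∈D q∈D refl refl = proj₂ conv y x₁ x₂ x p∈D q∈D

  run-N : ∀ {x y y′} → (x , y) ∈ D → (x , y′) ∈ D → y ℤ.≤ y′ → Run D N (x , y) (x , y′)
  run-N {x} = run-up (x ,_) (λ _ → refl) (λ p q → column-convex p q refl refl)

  run-S : ∀ {x y y′} → (x , y) ∈ D → (x , y′) ∈ D → y′ ℤ.≤ y → Run D S (x , y) (x , y′)
  run-S {x} = run-down (x ,_) (λ _ → refl) (λ p q → column-convex p q refl refl)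

  run-E : ∀ {x x′ y} → (x , y) ∈ D → (x′ , y) ∈ D → x ℤ.≤ x′ → Run D E (x , y) (x′ , y)
  run-E {y = y} = run-up (_, y) (λ _ → refl) (λ p q → row-convex p q refl refl)

  run-W : ∀ {x x′ y} → (x , y) ∈ D → (x′ , y) ∈ D → x′ ℤ.≤ x → Run D W (x , y) (x′ , y)
  run-W {y = y} = run-down (_, y) (λ _ → refl) (λ p q → row-convex p q refl refl)

data Runs (D : CellSet) (h v : Step) : Cell → Cell → ℕ → Set where
  []   : ∀ {a} → Runs D h v a a 0
  step : ∀ {a b c m} d → d ≡ h ⊎ d ≡ v → Run D d a b → Runs D h v b c m → Runs D h v a c (suc m)

Runs-snoc : ∀ {D h v a b c m} → Runs D h v a b m →
  ∀ d → d ≡ h ⊎ d ≡ v → Run D d b c → Runs D h v a c (suc m)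
Runs-snoc []                    d d∈hv r = step d d∈hv r []
Runs-snoc (step d′ d′∈hv r′ rs) d d∈hv r = step d′ d′∈hv r′ (Runs-snoc rs d d∈hv r)

Runs⇒steps : ∀ {D h v a c m} → a ∈ D → Runs D h v a c m →
  ∃[ ss ] All (λ u → u ≡ h ⊎ u ≡ v) ss × All (_∈ D) (visits a ss) × endCell a ss ≡ c ×
          changes ss ≤ m ∸ 1
Runs⇒steps a∈D [] = [] , [] , a∈D ∷ [] , refl , z≤n
Runs⇒steps _ (step d d∈hv (n , seg , refl) []) =
  replicate n d , replicate⁺ n d∈hv , seg , refl , ℕₚ.≤-reflexive (changes-replicate n d)
Runs⇒steps {a = a} _ (step d d∈hv (n , seg , refl) rs@(step _ _ _ _))
  with Runs⇒steps (All-endCell a (replicate n d) seg) rs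
... | ss , ss∈hv , vis , end , ch =
  replicate n d ++ ss , ++⁺ (replicate⁺ n d∈hv) ss∈hv , visits-++ a (replicate n d) ss seg vis ,
  trans (endCell-++ a (replicate n d) ss) end , ℕₚ.≤-trans (changes-replicate-++ n d ss) (s≤s ch)

-- A monotone step sequence is self-avoiding: it strictly increases the potential.
Runs⇒monotone-path : ∀ {D h v a c m} → Vertical h → Horizontal v → a ∈ D → Runs D h v a c m →
  ∃[ ss ] Monotone ss × IsPath D a c ss × changes ss ≤ m ∸ 1
Runs⇒monotone-path {h = h} {v} {a} vert hor a∈D rs with Runs⇒steps a∈D rs
... | ss , ss∈hv , vis , end , ch =
  ss , (h , v , ss∈hv) , (visits-unique (potential h v) a ss (All.map increases ss∈hv) , vis , end) , ch
  where
  increases : ∀ {u} → u ≡ h ⊎ u ≡ v → Increases (potential h v) u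
  increases (inj₁ refl) = potential-vertical vert v
  increases (inj₂ refl) = potential-horizontal hor h

-- Chains of aligned cells

infix  4 _⊑_ _↗_
infixr 7 _∧_
infixr 6 _∨_

_⊑_ : Cell → Cell → Set
a ⊑ b = proj₁ a ℤ.≤ proj₁ b × proj₂ a ℤ.≤ proj₂ b

⊑-refl : ∀ {a} → a ⊑ a
⊑-refl = ℤₚ.≤-refl , ℤₚ.≤-refl

⊑-trans : ∀ {a b c} → a ⊑ b → b ⊑ c → a ⊑ c
⊑-trans (x₁ , y₁) (x₂ , y₂) = ℤₚ.≤-trans x₁ x₂ , ℤₚ.≤-trans y₁ y₂

_∧_ : Cell → Cell → Cell
a ∧ b = proj₁ a ⊓ proj₁ b , proj₂ a ⊓ proj₂ b

_∨_ : Cell → Cell → Cell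
a ∨ b = proj₁ a ⊔ proj₁ b , proj₂ a ⊔ proj₂ b

Aligned : Cell → Cell → Set
Aligned a b = proj₁ a ≡ proj₁ b ⊎ proj₂ a ≡ proj₂ b

_↗_ : Cell → Cell → Set
a ↗ b = Aligned a b × a ⊑ b

data Chain (D : CellSet) (_~_ : Cell → Cell → Set) : Cell → Cell → ℕ → Set where
  []   : ∀ {a} → Chain D _~_ a a 0
  link : ∀ {a b c n} → b ∈ D → a ~ b → Chain D _~_ b c n → Chain D _~_ a c (suc n)

↗-chain-⊑ : ∀ {D a c m} → Chain D _↗_ a c m → a ⊑ c
↗-chain-⊑ []                   = ⊑-refl
↗-chain-⊑ (link _ (_ , a⊑b) bc) = ⊑-trans a⊑b (↗-chain-⊑ bc)

axis : Step → Cell → ℤ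
axis N = proj₁
axis S = proj₁
axis E = proj₂
axis W = proj₂

axis-move : ∀ s p → axis s (move s p) ≡ axis s p
axis-move N _ = refl
axis-move S _ = refl
axis-move E _ = refl
axis-move W _ = refl

axis-aligned : ∀ s {p q} → axis s p ≡ axis s q → Aligned p q
axis-aligned N = inj₁
axis-aligned S = inj₁
axis-aligned E = inj₂
axis-aligned W = inj₂

-- q is the first corner of the path: the end of its initial straight run.
first-corner : ∀ {D} p s ss → All (_∈ D) (visits p (s ∷ ss)) →
  ∃[ q ] axis s p ≡ axis s q × q ∈ D ×
    ∃[ n ] Chain D Aligned q (endCell p (s ∷ ss)) n × n ≤ changes (s ∷ ss)
first-corner p s []       (_ ∷ q∈D ∷ []) = move s p , sym (axis-move s p) , q∈D , 0 , [] , z≤n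
first-corner p s (t ∷ ss) (_ ∷ vis) with first-corner (move s p) t ss vis | ≡⊎differ≡1 s t
... | q , pq , q∈D , n , ch , n≤ | inj₁ refl =
  q , trans (sym (axis-move s p)) pq , q∈D , n , ch , subst (n ≤_) (sym (changes-repeat s ss)) n≤
... | q , pq , q∈D , n , ch , n≤ | inj₂ differ≡1 =
  move s p , sym (axis-move s p) , All.head vis , suc n , link q∈D (axis-aligned t pq) ch ,
  subst (λ c → suc n ≤ c ℕ.+ changes (t ∷ ss)) (sym differ≡1) (s≤s n≤)

path⇒chain : ∀ {D} p ss → All (_∈ D) (visits p ss) →
  ∃[ m ] m ≤ suc (changes ss) × Chain D Aligned p (endCell p ss) m
path⇒chain p []       _   = 0 , z≤n , []
path⇒chain p (s ∷ ss) vis with first-corner p s ss vis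
... | q , pq , q∈D , n , ch , n≤ = suc n , s≤s n≤ , link q∈D (axis-aligned s pq) ch

module _ {D : CellSet} (conv : Convex D) where

  ↗-chain⇒runs : ∀ {a c m} → a ∈ D → Chain D _↗_ a c m → Runs D N E a c m
  ↗-chain⇒runs a∈D [] = []
  ↗-chain⇒runs {a = _ , _} a∈D (link {b = _ , _} b∈D (inj₁ refl , _ , y≤y′) bc) =
    step N (inj₁ refl) (run-N conv a∈D b∈D y≤y′) (↗-chain⇒runs b∈D bc)
  ↗-chain⇒runs {a = _ , _} a∈D (link {b = _ , _} b∈D (inj₂ refl , x≤x′ , _) bc) =
    step E (inj₂ refl) (run-E conv a∈D b∈D x≤x′) (↗-chain⇒runs b∈D bc)

  ↗-chain⇒reverse-runs : ∀ {a c m} → a ∈ D → Chain D _↗_ a c m → Runs D S W c a m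
  ↗-chain⇒reverse-runs a∈D [] = []
  ↗-chain⇒reverse-runs {a = _ , _} a∈D (link {b = _ , _} b∈D (inj₁ refl , _ , y≤y′) bc) =
    Runs-snoc (↗-chain⇒reverse-runs b∈D bc) S (inj₁ refl) (run-S conv b∈D a∈D y≤y′)
  ↗-chain⇒reverse-runs {a = _ , _} a∈D (link {b = _ , _} b∈D (inj₂ refl , x≤x′ , _) bc) =
    Runs-snoc (↗-chain⇒reverse-runs b∈D bc) W (inj₂ refl) (run-W conv b∈D a∈D x≤x′)

NorthEast : Step → Set
NorthEast u = u ≡ N ⊎ u ≡ E

+1≤ : ∀ {i j} → i ℤ.< j → i ℤ.+ + 1 ℤ.≤ j
+1≤ {i} {j} i<j = subst (ℤ._≤ j) (ℤₚ.+-comm (+ 1) i) (ℤₚ.i<j⇒suc[i]≤j i<j)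

⊑-move : ∀ {u} → NorthEast u → ∀ p → p ⊑ move u p
⊑-move (inj₁ refl) (x , y) = ℤₚ.≤-refl , ℤₚ.<⇒≤ (i<i+1 y)
⊑-move (inj₂ refl) (x , y) = ℤₚ.<⇒≤ (i<i+1 x) , ℤₚ.≤-refl

⊑-endCell : ∀ p ss → All NorthEast ss → p ⊑ endCell p ss
⊑-endCell p []       []         = ⊑-refl
⊑-endCell p (u ∷ ss) (ne ∷ nes) = ⊑-trans (⊑-move ne p) (⊑-endCell (move u p) ss nes)

OnSWRays : Cell → Cell → Set
OnSWRays (X , Y) (x , y) = (x ≡ X × y ℤ.≤ Y) ⊎ (y ≡ Y × x ℤ.≤ X)

OnNERays : Cell → Cell → Set
OnNERays (X , Y) (x , y) = (x ≡ X × Y ℤ.≤ y) ⊎ (y ≡ Y × X ℤ.≤ x)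

onSWRays? : ∀ T p → Dec (OnSWRays T p)
onSWRays? (X , Y) (x , y) = (x ℤ.≟ X ×-dec y ℤ.≤? Y) ⊎-dec (y ℤ.≟ Y ×-dec x ℤ.≤? X)

onNERays? : ∀ T p → Dec (OnNERays T p)
onNERays? (X , Y) (x , y) = (x ℤ.≟ X ×-dec Y ℤ.≤? y) ⊎-dec (y ℤ.≟ Y ×-dec X ℤ.≤? x)

NE-path-meets-SWRays : ∀ T p ss → All NorthEast ss → p ⊑ T → T ⊑ endCell p ss →
  Any (OnSWRays T) (visits p ss)
NE-path-meets-SWRays T p [] [] (x≤X , y≤Y) (X≤x , _) = here (inj₁ (ℤₚ.≤-antisym x≤X X≤x , y≤Y))
NE-path-meets-SWRays T p (u ∷ ss) (ne ∷ nes) p⊑T T⊑e with onSWRays? T p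
... | yes on = here on
... | no off = there (NE-path-meets-SWRays T (move u p) ss nes (step-⊑ ne) T⊑e)
  where
  x<X : proj₁ p ℤ.< proj₁ T
  x<X = ℤₚ.≤∧≢⇒< (proj₁ p⊑T) (λ x≡X → off (inj₁ (x≡X , proj₂ p⊑T)))
  y<Y : proj₂ p ℤ.< proj₂ T
  y<Y = ℤₚ.≤∧≢⇒< (proj₂ p⊑T) (λ y≡Y → off (inj₂ (y≡Y , proj₁ p⊑T)))
  step-⊑ : ∀ {u} → NorthEast u → move u p ⊑ T
  step-⊑ (inj₁ refl) = ℤₚ.<⇒≤ x<X , +1≤ y<Y
  step-⊑ (inj₂ refl) = +1≤ x<X , ℤₚ.<⇒≤ y<Y

off-NERays⇒< : ∀ T p → proj₁ p ℤ.≤ proj₁ T ⊎ proj₂ p ℤ.≤ proj₂ T → ¬ OnNERays T p →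
  proj₁ p ℤ.< proj₁ T ⊎ proj₂ p ℤ.< proj₂ T
off-NERays⇒< (X , Y) (x , y) x≤X⊎y≤Y off with x≤X⊎y≤Y | x ℤ.≟ X | y ℤ.≟ Y
... | inj₁ x≤X | no x≢X  | _       = inj₁ (ℤₚ.≤∧≢⇒< x≤X x≢X)
... | inj₁ _   | yes x≡X | _       = inj₂ (ℤₚ.≰⇒> (λ Y≤y → off (inj₁ (x≡X , Y≤y))))
... | inj₂ y≤Y | _       | no y≢Y  = inj₂ (ℤₚ.≤∧≢⇒< y≤Y y≢Y)
... | inj₂ _   | _       | yes y≡Y = inj₁ (ℤₚ.≰⇒> (λ X≤x → off (inj₂ (y≡Y , X≤x))))

move-⋢ : ∀ {T u} p → NorthEast u → proj₁ p ℤ.< proj₁ T ⊎ proj₂ p ℤ.< proj₂ T →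
  proj₁ (move u p) ℤ.≤ proj₁ T ⊎ proj₂ (move u p) ℤ.≤ proj₂ T
move-⋢ _ (inj₁ refl) (inj₁ x<X) = inj₁ (ℤₚ.<⇒≤ x<X)
move-⋢ _ (inj₁ refl) (inj₂ y<Y) = inj₂ (+1≤ y<Y)
move-⋢ _ (inj₂ refl) (inj₁ x<X) = inj₁ (+1≤ x<X)
move-⋢ _ (inj₂ refl) (inj₂ y<Y) = inj₂ (ℤₚ.<⇒≤ y<Y)

NE-path-meets-NERays : ∀ T p ss → All NorthEast ss →
  proj₁ p ℤ.≤ proj₁ T ⊎ proj₂ p ℤ.≤ proj₂ T → T ⊑ endCell p ss → Any (OnNERays T) (visits p ss)
NE-path-meets-NERays T p [] [] (inj₁ x≤X) (X≤x , Y≤y) = here (inj₁ (ℤₚ.≤-antisym x≤X X≤x , Y≤y))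
NE-path-meets-NERays T p [] [] (inj₂ y≤Y) (X≤x , Y≤y) = here (inj₂ (ℤₚ.≤-antisym y≤Y Y≤y , X≤x))
NE-path-meets-NERays T p (u ∷ ss) (ne ∷ nes) p⋢T T⊑e with onNERays? T p
... | yes on = here on
... | no off =
  there (NE-path-meets-NERays T (move u p) ss nes (move-⋢ p ne (off-NERays⇒< T p p⋢T off)) T⊑e)

-- Meets and joins in a directed convex polyomino

∧-aligned : ∀ {a b s} → Aligned a b → s ⊑ b → Aligned (a ∧ s) s
∧-aligned (inj₁ x≡) (sx≤ , _) = inj₁ (ℤₚ.i≥j⇒i⊓j≡j (ℤₚ.≤-trans sx≤ (ℤₚ.≤-reflexive (sym x≡))))
∧-aligned (inj₂ y≡) (_ , sy≤) = inj₂ (ℤₚ.i≥j⇒i⊓j≡j (ℤₚ.≤-trans sy≤ (ℤₚ.≤-reflexive (sym y≡))))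

∨-aligned : ∀ b {a a′} → Aligned a a′ → Aligned (b ∨ a) (b ∨ a′)
∨-aligned b (inj₁ x≡) = inj₁ (cong (proj₁ b ⊔_) x≡)
∨-aligned b (inj₂ y≡) = inj₂ (cong (proj₂ b ⊔_) y≡)

∨-monoʳ : ∀ b {a a′} → a ⊑ a′ → b ∨ a ⊑ b ∨ a′
∨-monoʳ b (x≤ , y≤) = ℤₚ.⊔-monoʳ-≤ (proj₁ b) x≤ , ℤₚ.⊔-monoʳ-≤ (proj₂ b) y≤

∈-cong₂ : ∀ {D : CellSet} {x y x′ y′} → x′ ≡ x → y′ ≡ y → (x , y) ∈ D → (x′ , y′) ∈ D
∈-cong₂ refl refl c∈D = c∈D

module _ {D : CellSet} {R : Cell} (conv : Convex D) (dir : Directed D R) where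

  root-⊑ : ∀ {c} → c ∈ D → R ⊑ c
  root-⊑ {c} c∈D with proj₂ dir c c∈D
  ... | ss , nes , (_ , _ , refl) = ⊑-endCell R ss nes

  lower-corner : ∀ {a b} → a ∈ D → b ∈ D → proj₁ a ℤ.≤ proj₁ b → proj₂ b ℤ.≤ proj₂ a →
    (proj₁ a , proj₂ b) ∈ D
  lower-corner {a} {b} a∈D b∈D ax≤bx by≤ay with proj₂ dir b b∈D
  ... | ss , nes , (_ , vis , refl)
    with All.lookupAny vis (NE-path-meets-SWRays (proj₁ a , proj₂ b) R ss nes
           (proj₁ (root-⊑ a∈D) , proj₂ (root-⊑ b∈D)) (ax≤bx , ℤₚ.≤-refl))
  ... | q∈D , inj₁ (qx≡ax , qy≤by) = column-convex conv q∈D a∈D qx≡ax refl qy≤by by≤ay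
  ... | q∈D , inj₂ (qy≡by , qx≤ax) = row-convex conv q∈D b∈D qy≡by refl qx≤ax ax≤bx

  upper-corner : ∀ {a b c} → a ∈ D → b ∈ D → c ∈ D → a ⊑ c → b ⊑ c →
    proj₁ a ℤ.≤ proj₁ b → proj₂ b ℤ.≤ proj₂ a → (proj₁ b , proj₂ a) ∈ D
  upper-corner {a} {b} {c} a∈D b∈D c∈D a⊑c b⊑c ax≤bx by≤ay with proj₂ dir c c∈D
  ... | ss , nes , (_ , vis , refl)
    with All.lookupAny vis (NE-path-meets-NERays (proj₁ b , proj₂ a) R ss nes
           (inj₁ (proj₁ (root-⊑ b∈D))) (proj₁ b⊑c , proj₂ a⊑c))
  ... | q∈D , inj₁ (qx≡bx , ay≤qy) = column-convex conv b∈D q∈D refl qx≡bx by≤ay ay≤qy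
  ... | q∈D , inj₂ (qy≡ay , bx≤qx) = row-convex conv a∈D q∈D refl qy≡ay ax≤bx bx≤qx

  ∧-closed : ∀ {a b} → a ∈ D → b ∈ D → a ∧ b ∈ D
  ∧-closed {a} {b} a∈D b∈D with ℤₚ.≤-total (proj₁ a) (proj₁ b) | ℤₚ.≤-total (proj₂ a) (proj₂ b)
  ... | inj₁ ax≤bx | inj₁ ay≤by = ∈-cong₂ (ℤₚ.i≤j⇒i⊓j≡i ax≤bx) (ℤₚ.i≤j⇒i⊓j≡i ay≤by) a∈D
  ... | inj₁ ax≤bx | inj₂ by≤ay = ∈-cong₂ (ℤₚ.i≤j⇒i⊓j≡i ax≤bx) (ℤₚ.i≥j⇒i⊓j≡j by≤ay)
                                     (lower-corner a∈D b∈D ax≤bx by≤ay)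
  ... | inj₂ bx≤ax | inj₁ ay≤by = ∈-cong₂ (ℤₚ.i≥j⇒i⊓j≡j bx≤ax) (ℤₚ.i≤j⇒i⊓j≡i ay≤by)
                                     (lower-corner b∈D a∈D bx≤ax ay≤by)
  ... | inj₂ bx≤ax | inj₂ by≤ay = ∈-cong₂ (ℤₚ.i≥j⇒i⊓j≡j bx≤ax) (ℤₚ.i≥j⇒i⊓j≡j by≤ay) b∈D

  ∨-closed : ∀ {a b c} → a ∈ D → b ∈ D → c ∈ D → a ⊑ c → b ⊑ c → a ∨ b ∈ D
  ∨-closed {a} {b} a∈D b∈D c∈D a⊑c b⊑c
    with ℤₚ.≤-total (proj₁ a) (proj₁ b) | ℤₚ.≤-total (proj₂ a) (proj₂ b)
  ... | inj₁ ax≤bx | inj₁ ay≤by = ∈-cong₂ (ℤₚ.i≤j⇒i⊔j≡j ax≤bx) (ℤₚ.i≤j⇒i⊔j≡j ay≤by) b∈D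
  ... | inj₁ ax≤bx | inj₂ by≤ay = ∈-cong₂ (ℤₚ.i≤j⇒i⊔j≡j ax≤bx) (ℤₚ.i≥j⇒i⊔j≡i by≤ay)
                                     (upper-corner a∈D b∈D c∈D a⊑c b⊑c ax≤bx by≤ay)
  ... | inj₂ bx≤ax | inj₁ ay≤by = ∈-cong₂ (ℤₚ.i≥j⇒i⊔j≡i bx≤ax) (ℤₚ.i≤j⇒i⊔j≡j ay≤by)
                                     (upper-corner b∈D a∈D c∈D b⊑c a⊑c bx≤ax ay≤by)
  ... | inj₂ bx≤ax | inj₂ by≤ay = ∈-cong₂ (ℤₚ.i≥j⇒i⊔j≡i bx≤ax) (ℤₚ.i≥j⇒i⊔j≡i by≤ay) a∈D

  -- Each corner is replaced by the meet of itself and all later corners.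
  monotone-below : ∀ {a c m} → a ∈ D → Chain D Aligned a c m →
    ∃[ s ] s ∈ D × s ⊑ a × Chain D _↗_ s c m
  monotone-below a∈D [] = _ , a∈D , ⊑-refl , []
  monotone-below {a} a∈D (link b∈D ab bc) with monotone-below b∈D bc
  ... | s , s∈D , s⊑b , sc =
    a ∧ s , ∧-closed a∈D s∈D , (ℤₚ.i⊓j≤i _ _ , ℤₚ.i⊓j≤i _ _) ,
    link s∈D (∧-aligned ab s⊑b , ℤₚ.i⊓j≤j _ _ , ℤₚ.i⊓j≤j _ _) sc

  ∨-chain : ∀ {a b c m} → b ∈ D → c ∈ D → b ⊑ c → Chain D _↗_ a c m → Chain D _↗_ (b ∨ a) c m
  ∨-chain {c = c} _ _ (bx≤cx , by≤cy) [] =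
    subst (λ z → Chain D _↗_ z c 0) (sym (cong₂ _,_ (ℤₚ.i≤j⇒i⊔j≡j bx≤cx) (ℤₚ.i≤j⇒i⊔j≡j by≤cy))) []
  ∨-chain {b = b} b∈D c∈D b⊑c (link a′∈D (aligned , a⊑a′) rest) =
    link (∨-closed b∈D a′∈D c∈D b⊑c (↗-chain-⊑ rest)) (∨-aligned b aligned , ∨-monoʳ b a⊑a′)
         (∨-chain b∈D c∈D b⊑c rest)

  -- Since R ⊑ b, joining b to the meets of an aligned chain from R gives a chain starting at b.
  monotone-chain : ∀ {b c m} → b ∈ D → c ∈ D → b ⊑ c → Chain D Aligned R c m → Chain D _↗_ b c m
  monotone-chain {b} {c} {m} b∈D c∈D b⊑c chain with monotone-below (proj₁ dir) chain
  ... | s , _ , s⊑R , sc = subst (λ z → Chain D _↗_ z c m) b∨s≡b (∨-chain b∈D c∈D b⊑c sc)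
    where
    s⊑b : s ⊑ b
    s⊑b = ⊑-trans s⊑R (root-⊑ b∈D)
    b∨s≡b : b ∨ s ≡ b
    b∨s≡b = cong₂ _,_ (ℤₚ.i≥j⇒i⊔j≡i (proj₁ s⊑b)) (ℤₚ.i≥j⇒i⊔j≡i (proj₂ s⊑b))

-- Monotone paths with few turns

module _ {D : CellSet} {R : Cell} (conv : Convex D) (dir : Directed D R) {k : ℕ} (1≤k : 1 ≤ k)
         (few-turns : ∀ c → c ∈ D → ∃[ ss ] IsPath D R c ss × changes ss ≤ k) where

  ↗-chain : ∀ {b c} → b ∈ D → c ∈ D → b ⊑ c → ∃[ m ] m ≤ suc k × Chain D _↗_ b c m
  ↗-chain {c = c} b∈D c∈D b⊑c with few-turns c c∈D
  ... | ss , (_ , vis , refl) , ss≤k with path⇒chain R ss vis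
  ... | m , m≤ , chain = m , ℕₚ.≤-trans m≤ (s≤s ss≤k) , monotone-chain conv dir b∈D c∈D b⊑c chain

  runs⇒path : ∀ {h v b c m} → Vertical h → Horizontal v → b ∈ D → Runs D h v b c m → m ≤ suc k →
    ∃[ ss ] Monotone ss × IsPath D b c ss × changes ss ≤ k
  runs⇒path vert hor b∈D rs m≤ with Runs⇒monotone-path vert hor b∈D rs
  ... | ss , mono , path , ch = ss , mono , path , ℕₚ.≤-trans ch (ℕₚ.∸-monoˡ-≤ 1 m≤)

  monotone-path : ∀ b c → b ∈ D → c ∈ D → ∃[ ss ] Monotone ss × IsPath D b c ss × changes ss ≤ k
  monotone-path (bx , by) (cx , cy) b∈D c∈D with ℤₚ.≤-total bx cx | ℤₚ.≤-total by cy
  ... | inj₁ bx≤cx | inj₁ by≤cy with ↗-chain b∈D c∈D (bx≤cx , by≤cy)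
  ...   | m , m≤ , chain = runs⇒path north east b∈D (↗-chain⇒runs conv b∈D chain) m≤
  monotone-path _ _ b∈D c∈D | inj₂ cx≤bx | inj₂ cy≤by with ↗-chain c∈D b∈D (cx≤bx , cy≤by)
  ...   | m , m≤ , chain = runs⇒path south west b∈D (↗-chain⇒reverse-runs conv c∈D chain) m≤
  monotone-path _ _ b∈D c∈D | inj₁ bx≤cx | inj₂ cy≤by =
    runs⇒path south east b∈D
      (step S (inj₁ refl) (run-S conv b∈D corner cy≤by) (step E (inj₂ refl) (run-E conv corner c∈D bx≤cx) []))
      (s≤s 1≤k)
    where corner = lower-corner conv dir b∈D c∈D bx≤cx cy≤by
  monotone-path _ _ b∈D c∈D | inj₂ cx≤bx | inj₁ by≤cy =
    runs⇒path north west b∈D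
      (step W (inj₂ refl) (run-W conv b∈D corner cx≤bx) (step N (inj₁ refl) (run-N conv corner c∈D by≤cy) []))
      (s≤s 1≤k)
    where corner = lower-corner conv dir c∈D b∈D cx≤bx by≤cy

proposition15 : (D : CellSet) (R : Cell) (k : ℕ) → 1 ≤ k →
    Polyomino D → Convex D → Directed D R →
    (KConvex k D ⇔ (∀ c → c ∈ D → ∃[ ss ] IsPath D R c ss × changes ss ≤ k))
proposition15 D R k 1≤k _ conv dir = mk⇔ root-paths (λ few-turns → conv , monotone-path conv dir 1≤k few-turns)
  where
  root-paths : KConvex k D → ∀ c → c ∈ D → ∃[ ss ] IsPath D R c ss × changes ss ≤ k
  root-paths (_ , pairs) c c∈D with pairs R c (proj₁ dir) c∈D
  ... | ss , _ , path , ss≤k = ss , path , ss≤k
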